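{- Let $\varphi$ be an LTL formula over $\mathsf{Prop}$ and $Y\subseteq\mathsf{Prop}$ with $Y\subseteq\mathsf{Prop}(\varphi)$. Then there are at least $2|Y|-1$ distinct subformulas $\psi$ of $\varphi$ such that $Y\cap\mathsf{Prop}(\psi)\ne\emptyset$.
   Context: LTL formulas: $\varphi::=p\mid\circ\varphi\mid\varphi*\varphi$ with $\circ\in\{\neg,\mathbf{X},\mathbf{F},\mathbf{G}\}$ and $*$ a binary Boolean connective or one of $\mathbf{U},\mathbf{R},\mathbf{W},\mathbf{M}$. The set of subformulas is defined inductively: $\mathrm{SubF}(p)=\{p\}$, $\mathrm{SubF}(\circ\varphi)=\mathrm{SubF}(\varphi)\cup\{\circ\varphi\}$, $\mathrm{SubF}(\varphi_1*\varphi_2)=\mathrm{SubF}(\varphi_1)\cup\mathrm{SubF}(\varphi_2)\cup\{\varphi_1*\varphi_2\}$ (as a set, so shared subformulas count once). $\mathsf{Prop}(\varphi)=\mathsf{Prop}\cap\mathrm{SubF}(\varphi)$ is the set of propositions occurring in $\varphi$. -}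

module Defs where

open import Data.List using (List; length)
open import Data.List.Membership.Propositional using (_∈_)
open import Data.Product using (∃-syntax; _×_)

data UnOp : Set where
  neg X F G : UnOp

data BinOp : Set where
  and or impl iff xor : BinOp
  U R W M : BinOp

data LTL (Prop : Set) : Set where
  atom : Prop → LTL Prop
  un   : UnOp → LTL Prop → LTL Prop
  bin  : BinOp → LTL Prop → LTL Prop → LTL Prop

data _⊑_ {Prop : Set} : LTL Prop → LTL Prop → Set where
  here  : ∀ {φ} → φ ⊑ φ
  unArg : ∀ {ψ o φ} → ψ ⊑ φ → ψ ⊑ un o φ
  binL  : ∀ {ψ o φ₁ φ₂} → ψ ⊑ φ₁ → ψ ⊑ bin o φ₁ φ₂
  binR  : ∀ {ψ o φ₁ φ₂} → ψ ⊑ φ₂ → ψ ⊑ bin o φ₁ φ₂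

_∈Prop_ : {Prop : Set} → Prop → LTL Prop → Set
p ∈Prop φ = atom p ⊑ φ

Meets : {Prop : Set} → List Prop → LTL Prop → Set
Meets Y ψ = ∃[ y ] (y ∈ Y × y ∈Prop ψ)

{-# OPTIONS --safe #-}
module Submission where

open import Defs
open import Data.Nat using (ℕ; suc; _+_; _*_; _∸_; _≤_; _<_; z≤n; s≤s)
open import Data.Nat.Induction using (<-wellFounded)
open import Data.Nat.Properties
  using (≤-refl; +-assoc; +-identityʳ; +-mono-≤; +-monoˡ-≤; +-mono-<-≤; +-mono-≤-<;
         *-distribˡ-+; m≤n+m∸n; m≤n+o⇒m∸n≤o; m≤n⇒m≤1+n; module ≤-Reasoning)
open import Data.List using (List; []; _∷_; _++_; map; length)
open import Data.List.Properties using (length-++; length-map)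
open import Data.List.Membership.Propositional using (_∈_)
open import Data.List.Membership.Propositional.Properties using (∈-map⁺; ∈-map⁻; ∈-++⁺ˡ; ∈-++⁺ʳ; ∈-++⁻)
open import Data.List.Relation.Unary.All using (All; []; _∷_)
import Data.List.Relation.Unary.All as All
import Data.List.Relation.Unary.All.Properties as All
open import Data.List.Relation.Unary.AllPairs using ([]; _∷_)
open import Data.List.Relation.Unary.Any using (here; there)
open import Data.List.Relation.Unary.Unique.Propositional using (Unique)
import Data.List.Relation.Unary.Unique.Propositional.Properties as Unique
open import Data.List.Relation.Binary.Disjoint.Propositional using (Disjoint)
open import Data.List.Relation.Binary.Subset.Propositional using (_⊆_)
open import Data.List.Relation.Binary.Permutation.Propositional using (_↭_; prep; ↭-trans; ↭-sym; ↭⇒↭ₛ)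
open import Data.List.Relation.Binary.Permutation.Propositional.Properties using (shift; ∈-resp-↭; ↭-length)
import Data.List.Relation.Binary.Permutation.Setoid.Properties as Permutationₛ
open import Data.Product using (∃-syntax; ∃₂; _×_; _,_; proj₂; map₁; map₂)
open import Data.Sum using (_⊎_; inj₁; inj₂)
import Data.Sum as Sum
open import Data.Empty using (⊥-elim)
open import Function using (case_of_)
open import Induction.WellFounded using (Acc; acc)
open import Relation.Binary.PropositionalEquality using (_≡_; refl; sym; trans; cong; cong₂; subst; setoid)

-- The contraction of φ deletes every unary operator and replaces every cherry
-- bin o (atom a) (atom b) by its left leaf atom a; it strictly shrinks compound formulas.
-- Being a function on formulas, it lets distinct subformulas of the contraction be lifted
-- to distinct subformulas of φ, so no deduplication (which would need decidable equality
-- of propositions) is ever required. Every y ∈ Y, at its given occurrence, either survives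
-- the contraction or is the right leaf of a cherry of φ. By induction on size the survivors
-- Y′ yield 2|Y′| − 1 subformulas, and each pruned y adds two new ones, atom y and its
-- cherry: atom y meets no survivor, and the lifts are chosen among formulas that do not
-- collapse to an atom, whereas a cherry does.

module _ {A : Set} where

  partition-⊎ : ∀ {P Q : A → Set} {xs} → All (λ x → P x ⊎ Q x) xs →
                ∃₂ λ ys zs → All P ys × All Q zs × ys ++ zs ↭ xs
  partition-⊎ [] = [] , [] , [] , [] , _↭_.refl
  partition-⊎ (inj₁ p ∷ pqs) with ys , zs , ps , qs , ys++zs↭ ← partition-⊎ pqs =
    _ ∷ ys , zs , p ∷ ps , qs , prep _ ys++zs↭
  partition-⊎ (inj₂ q ∷ pqs) with ys , zs , ps , qs , ys++zs↭ ← partition-⊎ pqs =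
    ys , _ ∷ zs , ps , q ∷ qs , ↭-trans (shift _ ys zs) (prep _ ys++zs↭)

  preimages : ∀ {B : Set} {f : B → A} {Q : B → Set} {xs} →
              All (λ x → ∃[ b ] (f b ≡ x × Q b)) xs → ∃[ bs ] (map f bs ≡ xs × All Q bs)
  preimages [] = [] , refl , []
  preimages ((b , refl , q) ∷ rest) with bs , refl , qs ← preimages rest = b ∷ bs , refl , q ∷ qs

  Unique-++⁻ : ∀ xs {ys : List A} → Unique (xs ++ ys) → Unique xs × Unique ys × Disjoint xs ys
  Unique-++⁻ [] u = [] , u , λ ()
  Unique-++⁻ (x ∷ xs) (x∉ ∷ u) with uxs , uys , xs#ys ← Unique-++⁻ xs u =
    All.++⁻ˡ xs x∉ ∷ uxs , uys , λ where
      (here refl , v∈ys) → All.lookup (All.++⁻ʳ xs x∉) v∈ys refl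
      (there v∈xs , v∈ys) → xs#ys (v∈xs , v∈ys)

  Unique-resp-↭ : ∀ {xs ys : List A} → xs ↭ ys → Unique xs → Unique ys
  Unique-resp-↭ p = Permutationₛ.Unique-resp-↭ (setoid A) (↭⇒↭ₛ p)

m+n∸o≤m∸o+n : ∀ m n o → m + n ∸ o ≤ m ∸ o + n
m+n∸o≤m∸o+n m n o = m≤n+o⇒m∸n≤o (m + n) o (begin
  m + n           ≤⟨ +-monoˡ-≤ n (m≤n+m∸n m o) ⟩
  o + (m ∸ o) + n ≡⟨ +-assoc o (m ∸ o) n ⟩
  o + (m ∸ o + n) ∎)
  where open ≤-Reasoning

2*[m+n]∸1≤2*m∸1+[n+n] : ∀ m n → 2 * (m + n) ∸ 1 ≤ 2 * m ∸ 1 + (n + n)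
2*[m+n]∸1≤2*m∸1+[n+n] m n = begin
  2 * (m + n) ∸ 1   ≡⟨ cong (_∸ 1) (*-distribˡ-+ 2 m n) ⟩
  2 * m + 2 * n ∸ 1 ≤⟨ m+n∸o≤m∸o+n (2 * m) (2 * n) 1 ⟩
  2 * m ∸ 1 + 2 * n ≡⟨ cong (λ k → 2 * m ∸ 1 + (n + k)) (+-identityʳ n) ⟩
  2 * m ∸ 1 + (n + n) ∎
  where open ≤-Reasoning

module _ {P : Set} where

  ⊑-trans : {ψ χ φ : LTL P} → ψ ⊑ χ → χ ⊑ φ → ψ ⊑ φ
  ⊑-trans p here = p
  ⊑-trans p (unArg q) = unArg (⊑-trans p q)
  ⊑-trans p (binL q) = binL (⊑-trans p q)
  ⊑-trans p (binR q) = binR (⊑-trans p q)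

  atom-injective : ∀ {a b : P} → atom a ≡ atom b → a ≡ b
  atom-injective refl = refl

  Meets-⊑ : ∀ {Y} {ψ χ : LTL P} → ψ ⊑ χ → Meets Y ψ → Meets Y χ
  Meets-⊑ ψ⊑χ = map₂ (map₂ (λ p → ⊑-trans p ψ⊑χ))

  Meets-⊆ : ∀ {Y Z} {ψ : LTL P} → Y ⊆ Z → Meets Y ψ → Meets Z ψ
  Meets-⊆ Y⊆Z = map₂ (map₁ Y⊆Z)

  size : LTL P → ℕ
  size (atom _) = 1
  size (un _ φ) = suc (size φ)
  size (bin _ φ₁ φ₂) = suc (size φ₁ + size φ₂)

  data Compound : LTL P → Set where
    un  : ∀ {o φ} → Compound (un o φ)
    bin : ∀ {o φ₁ φ₂} → Compound (bin o φ₁ φ₂)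

  data BinView : LTL P → LTL P → Set where
    cherry    : ∀ a b → BinView (atom a) (atom b)
    notCherry : ∀ {φ₁ φ₂} → Compound φ₁ ⊎ Compound φ₂ → BinView φ₁ φ₂

  binView : ∀ φ₁ φ₂ → BinView φ₁ φ₂
  binView (atom a) (atom b) = cherry a b
  binView (atom a) (un _ _) = notCherry (inj₂ un)
  binView (atom a) (bin _ _ _) = notCherry (inj₂ bin)
  binView (un _ _) _ = notCherry (inj₁ un)
  binView (bin _ _ _) _ = notCherry (inj₁ bin)

  contract : LTL P → LTL P
  contract (atom a) = atom a
  contract (un o φ) = contract φ
  contract (bin o φ₁ φ₂) with binView φ₁ φ₂
  ... | cherry a b = atom a
  ... | notCherry _ = bin o (contract φ₁) (contract φ₂)

  contract-notCherry : ∀ {o φ₁ φ₂} → Compound φ₁ ⊎ Compound φ₂ →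
                       contract (bin o φ₁ φ₂) ≡ bin o (contract φ₁) (contract φ₂)
  contract-notCherry {φ₁ = φ₁} {φ₂} c with binView φ₁ φ₂
  contract-notCherry (inj₁ ()) | cherry a b
  contract-notCherry (inj₂ ()) | cherry a b
  ... | notCherry _ = refl

  contract-≤ : ∀ φ → size (contract φ) ≤ size φ
  contract-≤ (atom a) = ≤-refl
  contract-≤ (un o φ) = m≤n⇒m≤1+n (contract-≤ φ)
  contract-≤ (bin o φ₁ φ₂) with binView φ₁ φ₂
  ... | cherry a b = s≤s z≤n
  ... | notCherry _ = s≤s (+-mono-≤ (contract-≤ φ₁) (contract-≤ φ₂))

  contract-< : ∀ {φ} → Compound φ → size (contract φ) < size φ
  contract-< {un o φ} un = s≤s (contract-≤ φ)
  contract-< {bin o φ₁ φ₂} bin with binView φ₁ φ₂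
  ... | cherry a b = s≤s (s≤s z≤n)
  ... | notCherry (inj₁ c) = s≤s (+-mono-<-≤ (contract-< c) (contract-≤ φ₂))
  ... | notCherry (inj₂ c) = s≤s (+-mono-≤-< (contract-≤ φ₁) (contract-< c))

  NotCollapsed : LTL P → Set
  NotCollapsed ψ = ∀ {a} → contract ψ ≡ atom a → ψ ≡ atom a

  ⊑-contract⁻ : ∀ φ {ψ′} → ψ′ ⊑ contract φ → ∃[ ψ ] (ψ ⊑ φ × contract ψ ≡ ψ′ × NotCollapsed ψ)
  ⊑-contract⁻ (atom a) here = atom a , here , refl , λ e → e
  ⊑-contract⁻ (un o φ) q = map₂ (map₁ unArg) (⊑-contract⁻ φ q)
  ⊑-contract⁻ (bin o φ₁ φ₂) q with binView φ₁ φ₂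
  ⊑-contract⁻ (bin o _ _) here | cherry a b = atom a , binL here , refl , λ e → e
  ⊑-contract⁻ (bin o φ₁ φ₂) here | notCherry c =
    bin o φ₁ φ₂ , here , contract-notCherry c , λ e → case trans (sym (contract-notCherry c)) e of λ ()
  ⊑-contract⁻ (bin o φ₁ φ₂) (binL q) | notCherry _ = map₂ (map₁ binL) (⊑-contract⁻ φ₁ q)
  ⊑-contract⁻ (bin o φ₁ φ₂) (binR q) | notCherry _ = map₂ (map₁ binR) (⊑-contract⁻ φ₂ q)

  ∈Prop-contract⁻ : ∀ {y} φ → y ∈Prop contract φ → y ∈Prop φ
  ∈Prop-contract⁻ φ p with ψ , ψ⊑φ , e , nc ← ⊑-contract⁻ φ p with refl ← nc e = ψ⊑φ

  Meets-contract⁻ : ∀ {Y} φ → Meets Y (contract φ) → Meets Y φ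
  Meets-contract⁻ φ = map₂ (map₂ (∈Prop-contract⁻ φ))

  record Cherry : Set where
    constructor ⟨_,_,_⟩
    field
      op : BinOp
      left right : P

  open Cherry

  toLTL : Cherry → LTL P
  toLTL ⟨ o , a , b ⟩ = bin o (atom a) (atom b)

  toLTL-injective : ∀ {c d} → toLTL c ≡ toLTL d → c ≡ d
  toLTL-injective refl = refl

  Pruned : LTL P → P → Set
  Pruned φ y = ∃[ c ] (right c ≡ y × toLTL c ⊑ φ)

  Pruned-⊑ : ∀ {χ φ y} → χ ⊑ φ → Pruned χ y → Pruned φ y
  Pruned-⊑ χ⊑φ = map₂ (map₂ (λ p → ⊑-trans p χ⊑φ))

  survives-or-pruned : ∀ φ {y} → y ∈Prop φ → y ∈Prop contract φ ⊎ Pruned φ y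
  survives-or-pruned (atom a) here = inj₁ here
  survives-or-pruned (un o φ) (unArg p) = Sum.map₂ (Pruned-⊑ (unArg here)) (survives-or-pruned φ p)
  survives-or-pruned (bin o φ₁ φ₂) p with binView φ₁ φ₂
  survives-or-pruned (bin o _ _) (binL here) | cherry a b = inj₁ here
  survives-or-pruned (bin o _ _) (binR here) | cherry a b = inj₂ (⟨ o , a , b ⟩ , refl , here)
  survives-or-pruned (bin o φ₁ φ₂) (binL p) | notCherry _ =
    Sum.map binL (Pruned-⊑ (binL here)) (survives-or-pruned φ₁ p)
  survives-or-pruned (bin o φ₁ φ₂) (binR p) | notCherry _ =
    Sum.map binR (Pruned-⊑ (binR here)) (survives-or-pruned φ₂ p)

  ManyDistinct : (LTL P → Set) → List P → Set
  ManyDistinct Good Y = ∃[ Ψ ] (Unique Ψ × All Good Ψ × 2 * length Y ∸ 1 ≤ length Ψ)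

  SubformulaBound : LTL P → List P → Set
  SubformulaBound φ Y = ManyDistinct (λ ψ → ψ ⊑ φ × Meets Y ψ) Y

  SubformulaBound-resp-↭ : ∀ {φ Y Z} → Y ↭ Z → SubformulaBound φ Y → SubformulaBound φ Z
  SubformulaBound-resp-↭ Y↭Z (Ψ , u , good , bound) =
    Ψ , u , All.map (map₂ (Meets-⊆ (∈-resp-↭ Y↭Z))) good ,
    subst (λ n → 2 * n ∸ 1 ≤ length Ψ) (↭-length Y↭Z) bound

  atom-bound : ∀ a {Y} → Unique Y → All (_∈Prop atom a) Y → SubformulaBound (atom a) Y
  atom-bound a [] [] = [] , [] , [] , z≤n
  atom-bound a _ (here ∷ []) = atom a ∷ [] , [] ∷ [] , (here , a , here refl , here) ∷ [] , s≤s z≤n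
  atom-bound a ((a≢a ∷ _) ∷ _) (here ∷ here ∷ _) = ⊥-elim (a≢a refl)

  lift-meeting : ∀ φ {Y ψ′} → ψ′ ⊑ contract φ × Meets Y ψ′ →
                 ∃[ ψ ] (contract ψ ≡ ψ′ × (ψ ⊑ φ × Meets Y ψ) × NotCollapsed ψ)
  lift-meeting φ (q , m) with ψ , ψ⊑φ , refl , nc ← ⊑-contract⁻ φ q =
    ψ , refl , (ψ⊑φ , Meets-contract⁻ ψ m) , nc

  lift-bound : ∀ φ {Y} → SubformulaBound (contract φ) Y →
               ManyDistinct (λ ψ → (ψ ⊑ φ × Meets Y ψ) × NotCollapsed ψ) Y
  lift-bound φ {Y} (Ψ′ , u , good , bound)
    with L , refl , good′ ← preimages (All.map (lift-meeting φ) good) =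
    L , Unique.map⁻ u , good′ , subst (2 * length Y ∸ 1 ≤_) (length-map contract L) bound

  add-pruned : ∀ φ {Y} Cs → All (λ c → toLTL c ⊑ φ) Cs →
               Unique (map right Cs) → Disjoint Y (map right Cs) →
               ManyDistinct (λ ψ → (ψ ⊑ φ × Meets Y ψ) × NotCollapsed ψ) Y →
               SubformulaBound φ (Y ++ map right Cs)
  add-pruned φ {Y} Cs cs uD Y#D (L , uL , good , bound) =
    L ++ atoms ++ cherries ,
    Unique.++⁺ uL (Unique.++⁺ (Unique.map⁺ atom-injective uD) uCherries atoms#cherries) L#new ,
    All.++⁺ (All.map (λ (ok , _) → map₂ (Meets-⊆ ∈-++⁺ˡ) ok) good) (All.++⁺ goodAtoms goodCherries) ,
    count
    where
      D = map right Cs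
      atoms = map atom D
      cherries = map toLTL Cs

      uCherries : Unique cherries
      uCherries = Unique.map⁺ toLTL-injective (Unique.map⁻ uD)

      atoms#cherries : Disjoint atoms cherries
      atoms#cherries (v∈atoms , v∈cherries)
        with _ , _ , refl ← ∈-map⁻ atom v∈atoms
        with _ , _ , () ← ∈-map⁻ toLTL v∈cherries

      L#new : Disjoint L (atoms ++ cherries)
      L#new (v∈L , v∈new) with ∈-++⁻ atoms v∈new
      ... | inj₁ v∈atoms
        with z , z∈D , refl ← ∈-map⁻ atom v∈atoms
        with (_ , _ , z∈Y , here) , _ ← All.lookup good v∈L
        = Y#D (z∈Y , z∈D)
      ... | inj₂ v∈cherries
        with _ , _ , refl ← ∈-map⁻ toLTL v∈cherries
        = case proj₂ (All.lookup good v∈L) refl of λ ()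

      meets : ∀ {c} → c ∈ Cs → Meets (Y ++ D) (atom (right c))
      meets c∈Cs = _ , ∈-++⁺ʳ Y (∈-map⁺ right c∈Cs) , here

      goodAtoms : All (λ ψ → ψ ⊑ φ × Meets (Y ++ D) ψ) atoms
      goodAtoms = All.map⁺ (All.map⁺ (All.tabulate λ c∈Cs →
        ⊑-trans (binR here) (All.lookup cs c∈Cs) , meets c∈Cs))

      goodCherries : All (λ ψ → ψ ⊑ φ × Meets (Y ++ D) ψ) cherries
      goodCherries = All.map⁺ (All.tabulate λ c∈Cs →
        All.lookup cs c∈Cs , Meets-⊑ (binR here) (meets c∈Cs))

      count : 2 * length (Y ++ D) ∸ 1 ≤ length (L ++ atoms ++ cherries)
      count = begin
        2 * length (Y ++ D) ∸ 1
          ≡⟨ cong (λ k → 2 * k ∸ 1) (length-++ Y) ⟩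
        2 * (length Y + length D) ∸ 1
          ≤⟨ 2*[m+n]∸1≤2*m∸1+[n+n] (length Y) (length D) ⟩
        2 * length Y ∸ 1 + (length D + length D)
          ≤⟨ +-monoˡ-≤ (length D + length D) bound ⟩
        length L + (length D + length D)
          ≡⟨ cong₂ (λ k l → length L + (k + l))
               (sym (length-map atom D)) (trans (length-map right Cs) (sym (length-map toLTL Cs))) ⟩
        length L + (length atoms + length cherries)
          ≡⟨ cong (length L +_) (sym (length-++ atoms)) ⟩
        length L + length (atoms ++ cherries)
          ≡⟨ sym (length-++ L) ⟩
        length (L ++ atoms ++ cherries) ∎
        where open ≤-Reasoning

  contraction-step : ∀ φ {Y} →
                     (∀ {Y′} → Unique Y′ → All (_∈Prop contract φ) Y′ → SubformulaBound (contract φ) Y′) →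
                     Unique Y → All (_∈Prop φ) Y → SubformulaBound φ Y
  contraction-step φ bound′ uY ps
    with Y′ , D , ps′ , prs , Y′++D↭Y ← partition-⊎ (All.map (survives-or-pruned φ) ps)
    with Cs , refl , cs ← preimages {f = right} prs
    with uY′ , uD , Y′#D ← Unique-++⁻ Y′ (Unique-resp-↭ (↭-sym Y′++D↭Y) uY)
    = SubformulaBound-resp-↭ Y′++D↭Y (add-pruned φ Cs cs uD Y′#D (lift-bound φ (bound′ uY′ ps′)))

  subformula-bound : ∀ φ {Y} → Acc _<_ (size φ) → Unique Y → All (_∈Prop φ) Y → SubformulaBound φ Y
  subformula-bound (atom a) _ = atom-bound a
  subformula-bound φ@(un _ _) (acc rs) =
    contraction-step φ (subformula-bound (contract φ) (rs (contract-< {φ} un)))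
  subformula-bound φ@(bin _ _ _) (acc rs) =
    contraction-step φ (subformula-bound (contract φ) (rs (contract-< {φ} bin)))

lemma2 : {Prop : Set} (φ : LTL Prop) (Y : List Prop) → Unique Y
         → All (λ y → y ∈Prop φ) Y
         → ∃[ Ψ ] (Unique Ψ × All (λ ψ → ψ ⊑ φ × Meets Y ψ) Ψ
                   × 2 * length Y ∸ 1 ≤ length Ψ)
lemma2 φ Y = subformula-bound φ (<-wellFounded (size φ))
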